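{- Let $\mathcal{S}_1,\ldots,\mathcal{S}_n,\mathcal{S}$ be configuration spaces, let $C_1,C_1'\subseteq\mathcal{S}_1,\ldots,C_n,C_n'\subseteq\mathcal{S}_n$ with $C_k\preceq C_k'$ (set dominance) for all $1\le k\le n$, and let $f:2^{\mathcal{S}_1}\times\cdots\times 2^{\mathcal{S}_n}\to 2^{\mathcal{S}}$ be a function built as a composition of only the following basic operations: free product, application of safe constraints, application of $\preceq$-derivations, $k$-abstraction, and alternatives (union). Then $f(C_1,\ldots,C_n)\preceq f(C_1',\ldots,C_n')$.
   Context: A poset is a set $Q$ with partial order $\preceq_Q$. A configuration space is a product $\mathcal{S}=Q_1\times\cdots\times Q_n$ of finitely many posets, ordered by dominance: $(q_1,\ldots,q_n)\preceq(q_1',\ldots,q_n')$ iff $q_k\preceq_{Q_k}q_k'$ for all $k$. For $C,C'\subseteq\mathcal{S}$, set dominance $C\preceq C'$ means that for every $c\in C$ there is $c'\in C'$ with $c\preceq c'$. Basic operations on sets of configurations: (free product) $C_1\times C_2\subseteq\mathcal{S}_1\times\mathcal{S}_2$; (safe constraint) a set $D\subseteq\mathcal{S}$ such that $c_2\preceq c_1$ and $c_2\in D$ imply $c_1\in D$, applied to $C$ as $C\cap D$; ($\preceq$-derivation application) for $g:\mathcal{S}\to Q$ with $c\preceq c'\Rightarrow g(c)\preceq_Q g(c')$, $g(C)=\{(q_1,\ldots,q_n,g(q_1,\ldots,q_n))\mid (q_1,\ldots,q_n)\in C\}\subseteq\mathcal{S}\times Q$; ($k$-abstraction) removing the $k$-th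 coordinate from every configuration in $C$; (alternatives) $C_1\cup C_2$ for $C_1,C_2$ in the same configuration space. -}

module Defs where

open import Level using (0ℓ)
open import Data.Unit using (⊤; tt)
open import Data.Product using (Σ; ∃; _×_; _,_; proj₁; proj₂)
open import Data.List using (List; []; _∷_; _++_; [_]; length; removeAt)
open import Data.Nat using (ℕ)
open import Data.Sum using (_⊎_)
open import Data.Fin using (Fin; zero; suc)
open import Data.Vec using (Vec; lookup)
open import Relation.Unary using (Pred)
open import Relation.Binary.Bundles using (Poset)
open import Relation.Binary.PropositionalEquality using (_≡_)

-- A configuration space: a finite list of posets Q₁ … Qₙ (product ordered by dominance).
Space : Set₁
Space = List (Poset 0ℓ 0ℓ 0ℓ)

Conf : Space → Set
Conf []       = ⊤
Conf (P ∷ Ps) = Poset.Carrier P × Conf Ps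

_≼_ : {S : Space} → Conf S → Conf S → Set
_≼_ {[]}     _        _          = ⊤
_≼_ {P ∷ Ps} (q , qs) (q' , qs') = Poset._≤_ P q q' × (_≼_ {Ps} qs qs')

ConfSet : Space → Set₁
ConfSet S = Pred (Conf S) 0ℓ

_⊑_ : {S : Space} → ConfSet S → ConfSet S → Set
_⊑_ {S} C C' = ∀ (c : Conf S) → C c → ∃ λ (c' : Conf S) → C' c' × (c ≼ c')

split : (S₁ S₂ : Space) → Conf (S₁ ++ S₂) → Conf S₁ × Conf S₂
split []       S₂ c        = tt , c
split (P ∷ S₁) S₂ (q , c) with split S₁ S₂ c
... | (c₁ , c₂) = (q , c₁) , c₂

join : (S₁ S₂ : Space) → Conf S₁ → Conf S₂ → Conf (S₁ ++ S₂)
join []       S₂ _        c₂ = c₂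
join (P ∷ S₁) S₂ (q , c₁) c₂ = q , join S₁ S₂ c₁ c₂

removeConf : (S : Space) (k : Fin (length S)) → Conf S → Conf (removeAt S k)
removeConf (P ∷ S) zero    (q , c) = c
removeConf (P ∷ S) (suc k) (q , c) = q , removeConf S k c

Safe : (S : Space) → ConfSet S → Set
Safe S D = ∀ (c₁ c₂ : Conf S) → c₂ ≼ c₁ → D c₂ → D c₁

Monotone : (S : Space) (Q : Poset 0ℓ 0ℓ 0ℓ) → (Conf S → Poset.Carrier Q) → Set
Monotone S Q g = ∀ (c c' : Conf S) → c ≼ c' → Poset._≤_ Q (g c) (g c')

freeProduct : (S₁ S₂ : Space) → ConfSet S₁ → ConfSet S₂ → ConfSet (S₁ ++ S₂)
freeProduct S₁ S₂ C₁ C₂ c = C₁ (proj₁ (split S₁ S₂ c)) × C₂ (proj₂ (split S₁ S₂ c))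

constrain : (S : Space) → ConfSet S → ConfSet S → ConfSet S
constrain S D C c = C c × D c

derive : (S : Space) (Q : Poset 0ℓ 0ℓ 0ℓ) → (Conf S → Poset.Carrier Q)
       → ConfSet S → ConfSet (S ++ [ Q ])
derive S Q g C c' = ∃ λ (c : Conf S) → C c × (c' ≡ join S [ Q ] c (g c , tt))

abstraction : (S : Space) (k : Fin (length S)) → ConfSet S → ConfSet (removeAt S k)
abstraction S k C c' = ∃ λ (c : Conf S) → C c × (removeConf S k c ≡ c')

alternatives : (S : Space) → ConfSet S → ConfSet S → ConfSet S
alternatives S C₁ C₂ c = C₁ c ⊎ C₂ c

-- Functions f : 2^{S₁} × ⋯ × 2^{Sₙ} → 2^{S} built as compositions of the basic
-- operations: syntax of such compositions, with inputs indexed by Fin n.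
data Expr {n : ℕ} (Γ : Vec Space n) : Space → Set₁ where
  input  : (i : Fin n) → Expr Γ (lookup Γ i)
  prod   : {S₁ S₂ : Space} → Expr Γ S₁ → Expr Γ S₂ → Expr Γ (S₁ ++ S₂)
  safe   : {S : Space} (D : ConfSet S) → Safe S D → Expr Γ S → Expr Γ S
  deriv  : {S : Space} (Q : Poset 0ℓ 0ℓ 0ℓ) (g : Conf S → Poset.Carrier Q)
         → Monotone S Q g → Expr Γ S → Expr Γ (S ++ [ Q ])
  abstr  : {S : Space} (k : Fin (length S)) → Expr Γ S → Expr Γ (removeAt S k)
  alt    : {S : Space} → Expr Γ S → Expr Γ S → Expr Γ S

⟦_⟧ : {n : ℕ} {Γ : Vec Space n} {S : Space} → Expr Γ S
    → ((i : Fin n) → ConfSet (lookup Γ i)) → ConfSet S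
⟦ input i ⟧ C = C i
⟦ prod {S₁} {S₂} e₁ e₂ ⟧ C = freeProduct S₁ S₂ (⟦ e₁ ⟧ C) (⟦ e₂ ⟧ C)
⟦ safe {S} D _ e ⟧ C = constrain S D (⟦ e ⟧ C)
⟦ deriv {S} Q g _ e ⟧ C = derive S Q g (⟦ e ⟧ C)
⟦ abstr {S} k e ⟧ C = abstraction S k (⟦ e ⟧ C)
⟦ alt {S} e₁ e₂ ⟧ C = alternatives S (⟦ e₁ ⟧ C) (⟦ e₂ ⟧ C)

module Submission where

-- The proof is structural: each basic operation is shown to be
-- monotone in its set arguments on its own, and the theorem follows by
-- induction on the expression, applying the lemma for the outermost operation
-- to the induction hypotheses.
--
--   * free product: a pair of dominating configurations is joined; this needs
--     that split and join are mutually inverse and that join is monotone;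
--   * safe constraint: the dominating configuration stays in D because D is
--     upward closed;
--   * derivation: the derived coordinate is dominated since g is monotone;
--   * abstraction: removing a coordinate is monotone;
--   * alternatives: each branch is handled separately.

open import Defs
open import Data.Nat using (ℕ)
open import Data.Fin using (Fin; zero; suc)
open import Data.Vec using (Vec; lookup)
open import Data.List using ([]; _∷_; _++_; [_]; length)
open import Data.Unit using (tt)
open import Data.Product using (_×_; _,_; proj₁; proj₂)
open import Data.Sum using (inj₁; inj₂)
open import Relation.Binary.Bundles using (Poset)
open import Relation.Binary.PropositionalEquality using (_≡_; refl; sym; subst; cong)

split-join : (S₁ S₂ : Space) (a : Conf S₁) (b : Conf S₂)
           → split S₁ S₂ (join S₁ S₂ a b) ≡ (a , b)
split-join []       S₂ a       b = refl
split-join (P ∷ S₁) S₂ (q , a) b rewrite split-join S₁ S₂ a b = refl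

join-split : (S₁ S₂ : Space) (c : Conf (S₁ ++ S₂))
           → join S₁ S₂ (proj₁ (split S₁ S₂ c)) (proj₂ (split S₁ S₂ c)) ≡ c
join-split []       S₂ c       = refl
join-split (P ∷ S₁) S₂ (q , c) with split S₁ S₂ c | join-split S₁ S₂ c
... | (a , b) | eq = cong (q ,_) eq

join-mono : (S₁ S₂ : Space) {a a' : Conf S₁} {b b' : Conf S₂}
          → a ≼ a' → b ≼ b' → join S₁ S₂ a b ≼ join S₁ S₂ a' b'
join-mono []       S₂ _        b≼b' = b≼b'
join-mono (P ∷ S₁) S₂ (q≤q' , a≼a') b≼b' = q≤q' , join-mono S₁ S₂ a≼a' b≼b'

removeConf-mono : (S : Space) (k : Fin (length S)) {c c' : Conf S}
                → c ≼ c' → removeConf S k c ≼ removeConf S k c'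
removeConf-mono (P ∷ S) zero    (_ , c≼c')     = c≼c'
removeConf-mono (P ∷ S) (suc k) (q≤q' , c≼c') = q≤q' , removeConf-mono S k c≼c'

freeProduct-mono : (S₁ S₂ : Space) {C₁ C₁' : ConfSet S₁} {C₂ C₂' : ConfSet S₂}
                 → C₁ ⊑ C₁' → C₂ ⊑ C₂'
                 → freeProduct S₁ S₂ C₁ C₂ ⊑ freeProduct S₁ S₂ C₁' C₂'
freeProduct-mono S₁ S₂ {C₁' = C₁'} {C₂' = C₂'} C₁⊑ C₂⊑ c (a∈ , b∈)
  with C₁⊑ _ a∈ | C₂⊑ _ b∈
... | a' , a'∈ , a≼a' | b' , b'∈ , b≼b' =
  join S₁ S₂ a' b' , joined∈ , c≼joined
  where
  c≼joined : c ≼ join S₁ S₂ a' b'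
  c≼joined = subst (_≼ join S₁ S₂ a' b') (join-split S₁ S₂ c) (join-mono S₁ S₂ a≼a' b≼b')

  joined∈ : freeProduct S₁ S₂ C₁' C₂' (join S₁ S₂ a' b')
  joined∈ = subst (λ p → C₁' (proj₁ p) × C₂' (proj₂ p)) (sym (split-join S₁ S₂ a' b')) (a'∈ , b'∈)

constrain-mono : (S : Space) {D C C' : ConfSet S}
               → Safe S D → C ⊑ C' → constrain S D C ⊑ constrain S D C'
constrain-mono S safeD C⊑ c (c∈ , c∈D) with C⊑ c c∈
... | c' , c'∈ , c≼c' = c' , (c'∈ , safeD c' c c≼c' c∈D) , c≼c'

derive-mono : (S : Space) (Q : Poset _ _ _) (g : Conf S → Poset.Carrier Q) {C C' : ConfSet S}
            → Monotone S Q g → C ⊑ C' → derive S Q g C ⊑ derive S Q g C'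
derive-mono S Q g monoG C⊑ ._ (c , c∈ , refl) with C⊑ c c∈
... | c' , c'∈ , c≼c' =
  join S [ Q ] c' (g c' , tt) , (c' , c'∈ , refl) , join-mono S [ Q ] c≼c' (monoG c c' c≼c' , tt)

abstraction-mono : (S : Space) (k : Fin (length S)) {C C' : ConfSet S}
                 → C ⊑ C' → abstraction S k C ⊑ abstraction S k C'
abstraction-mono S k C⊑ ._ (c , c∈ , refl) with C⊑ c c∈
... | c' , c'∈ , c≼c' = removeConf S k c' , (c' , c'∈ , refl) , removeConf-mono S k c≼c'

alternatives-mono : (S : Space) {C₁ C₁' C₂ C₂' : ConfSet S}
                  → C₁ ⊑ C₁' → C₂ ⊑ C₂' → alternatives S C₁ C₂ ⊑ alternatives S C₁' C₂'
alternatives-mono S C₁⊑ C₂⊑ c (inj₁ c∈) with C₁⊑ c c∈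
... | c' , c'∈ , c≼c' = c' , inj₁ c'∈ , c≼c'
alternatives-mono S C₁⊑ C₂⊑ c (inj₂ c∈) with C₂⊑ c c∈
... | c' , c'∈ , c≼c' = c' , inj₂ c'∈ , c≼c'

theorem5p2 : {n : ℕ} (Γ : Vec Space n) {S : Space} (f : Expr Γ S)
    (C C' : (i : Fin n) → ConfSet (lookup Γ i))
    → ((k : Fin n) → C k ⊑ C' k)
    → ⟦ f ⟧ C ⊑ ⟦ f ⟧ C'
theorem5p2 Γ (input i) C C' C⊑C' = C⊑C' i
theorem5p2 Γ (prod {S₁} {S₂} e₁ e₂) C C' C⊑C' =
  freeProduct-mono S₁ S₂ (theorem5p2 Γ e₁ C C' C⊑C') (theorem5p2 Γ e₂ C C' C⊑C')
theorem5p2 Γ (safe {S} D safeD e) C C' C⊑C' =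
  constrain-mono S safeD (theorem5p2 Γ e C C' C⊑C')
theorem5p2 Γ (deriv {S} Q g monoG e) C C' C⊑C' =
  derive-mono S Q g monoG (theorem5p2 Γ e C C' C⊑C')
theorem5p2 Γ (abstr {S} k e) C C' C⊑C' =
  abstraction-mono S k (theorem5p2 Γ e C C' C⊑C')
theorem5p2 Γ (alt {S} e₁ e₂) C C' C⊑C' =
  alternatives-mono S (theorem5p2 Γ e₁ C C' C⊑C') (theorem5p2 Γ e₂ C C' C⊑C')
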